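{- Let $m\ge 3$ be an integer, let $a_1,\dots,a_n$ be positive integers with $\gcd(a_1,\dots,a_n)=1$, and let $p$ be an odd prime such that $a_i\in\mathbb Z_p^\times$ for at least five indices $i\in\{1,\dots,n\}$. Then for any $A,B,k\in\mathbb Z_p$, the equation $$\Big(B+k(m-2)-\sum_{i=2}^n a_ix_i\Big)^2+\sum_{i=2}^n a_1a_ix_i^2=2Aa_1+Ba_1+k(m-4)a_1$$ has a primitive solution $(x_2,\dots,x_n)\in\mathbb Z_p^{n-1}$.
   Context: A vector in $\mathbb Z_p^{n-1}$ is primitive if not all of its coordinates lie in $p\mathbb Z_p$. -}

module Defs where

open import Data.Nat as ℕ using (ℕ; zero; suc; _^_)
open import Data.Nat.GCD using (gcd)
open import Data.Fin using (Fin; zero; suc)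
open import Data.Integer as ℤ using (ℤ; +_; _+_; _-_; _*_)
open import Data.Integer.Divisibility using (_∣_)
open import Data.Product using (Σ; ∃)
open import Relation.Nullary using (¬_)

-- p-adic integers as the inverse limit  lim ℤ/p^k ℤ :
-- a compatible sequence of integer representatives x k of residues mod p^k.
record ℤₚ (p : ℕ) : Set where
  constructor mkℤₚ
  field
    res    : ℕ → ℤ
    compat : ∀ k → (+ (p ^ k)) ∣ (res (suc k) - res k)
open ℤₚ public

_≈ₚ_ : {p : ℕ} → ℤₚ p → ℤₚ p → Set
_≈ₚ_ {p} x y = ∀ k → (+ (p ^ k)) ∣ (res x k - res y k)

-- an integer a is a unit of ℤₚ : a * y = 1 in ℤₚ for some y
-- (ring operations of the inverse limit are componentwise mod p^k)
IsUnitℤₚ : (p : ℕ) → ℤ → Set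
IsUnitℤₚ p a = Σ (ℤₚ p) λ y → ∀ k → (+ (p ^ k)) ∣ (a * res y k - + 1)

In-pℤₚ : {p : ℕ} → ℤₚ p → Set
In-pℤₚ {p} x = Σ (ℤₚ p) λ y → ∀ k → (+ (p ^ k)) ∣ (res x k - + p * res y k)

Primitive : {p r : ℕ} → (Fin r → ℤₚ p) → Set
Primitive {r = r} x = ∃ λ (i : Fin r) → ¬ In-pℤₚ (x i)

Σℤ : (r : ℕ) → (Fin r → ℤ) → ℤ
Σℤ zero    f = + 0
Σℤ (suc r) f = f zero + Σℤ r (λ i → f (suc i))

gcdFin : (r : ℕ) → (Fin r → ℕ) → ℕ
gcdFin zero    f = 0
gcdFin (suc r) f = gcd (f zero) (gcdFin r (λ i → f (suc i)))

-- Write c = B + k(m − 2) and N = 2A + B + k(m − 4). If X ∈ ℤₚⁿ satisfies Σ aᵢXᵢ = c and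
-- Σ aᵢXᵢ² = N, then (X₂, …, Xₙ) solves the equation: with a₁X₁ = c − Σᵢ₌₂ aᵢXᵢ its two sides
-- differ by a₁(Σ aᵢXᵢ² − N). This system is solved using only five unit coefficients v₀, …, v₄,
-- ordered so that v₀ + v₁ is a unit. Modulo p, the system in v₀, …, v₃ has a solution with z₀ ≢ 0:
-- substitute pairs (r + v₁σ, r − v₀σ) and use that every residue is of the form αs² + βt².
-- Eliminating the fifth unknown through the linear equation leaves a single equation in y₀ whose
-- derivative at z₀ is 2v₄v₀z₀ ≢ 0, so Hensel's lemma lifts z₀ to a p-adic root; as it is a unit,
-- the solution is primitive.

module Submission where

open import Defs
open import Data.Nat as ℕ using (ℕ; zero; suc; _^_)
import Data.Nat.Properties as ℕP
import Data.Nat.Divisibility as ℕD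
open import Data.Nat.Primality using (Prime; euclidsLemma; prime⇒irreducible; prime⇒nonZero; prime⇒nonTrivial)
open import Data.Nat.Coprimality using (Coprime; coprime-Bézout)
open import Data.Nat.GCD using (module Bézout)
open import Data.Integer as ℤ using (ℤ; +_; -[1+_]; _+_; _-_; _*_; -_; ∣_∣; _≤_)
import Data.Integer.Properties as ℤP
open ℤP using (abs-*; +-identityˡ; pos-+; pos-*)
open import Data.Integer.Divisibility using (_∣_)
import Data.Integer.Divisibility.Signed as ℤS
open import Data.Integer.DivMod using (_%ℕ_; _/ℕ_; n%ℕd<d; a≡a%ℕn+[a/ℕn]*n)
open import Data.Integer.Tactic.RingSolver using (solve-∀)
open import Data.Fin as Fin using (Fin; zero; suc; toℕ; fromℕ<; splitAt; join)
import Data.Fin.Properties as FinP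
open FinP using (pigeonhole; toℕ-fromℕ<; toℕ<n; <-cmp; <⇒≢; join-splitAt)
open import Data.Product using (Σ; ∃; ∃₂; _×_; _,_; proj₁; proj₂)
open import Data.Sum using (_⊎_; inj₁; inj₂)
open import Data.Empty using (⊥-elim)
open import Function.Definitions using (Injective)
open import Function.Bundles using (Injection)
open import Function.Properties.Inverse using (↔⇒↣)
open import Data.Fin.Permutation as Perm using (Permutation′; _⟨$⟩ʳ_; _∘ₚ_; transpose)
open import Level using (0ℓ)
open import Relation.Binary.Bundles using (Setoid)
open import Relation.Nullary using (¬_; Dec; yes; no)
open import Relation.Binary.Definitions using (tri<; tri≈; tri>)
open import Relation.Binary.PropositionalEquality
  using (_≡_; _≢_; refl; sym; trans; cong; cong₂; subst; module ≡-Reasoning)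

infix 4 _≡_mod_

record _≡_mod_ (x y m : ℤ) : Set where
  constructor mod-by
  field
    quotient : ℤ
    equality : x ≡ y + quotient * m

module _ {m : ℤ} where

  ≡⇒mod : ∀ {x y} → x ≡ y → x ≡ y mod m
  ≡⇒mod {x} refl = mod-by (+ 0) (x≡x+0m x m)
    where x≡x+0m : ∀ x m → x ≡ x + + 0 * m
          x≡x+0m = solve-∀

  mod-refl : ∀ {x} → x ≡ x mod m
  mod-refl = ≡⇒mod refl

  mod-sym : ∀ {x y} → x ≡ y mod m → y ≡ x mod m
  mod-sym {y = y} (mod-by q refl) = mod-by (- q) (identity y q m)
    where identity : ∀ y q m → y ≡ (y + q * m) + (- q) * m
          identity = solve-∀

  mod-trans : ∀ {x y z} → x ≡ y mod m → y ≡ z mod m → x ≡ z mod m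
  mod-trans {z = z} (mod-by q refl) (mod-by q′ refl) = mod-by (q + q′) (identity z q q′ m)
    where identity : ∀ z q q′ m → z + q′ * m + q * m ≡ z + (q + q′) * m
          identity = solve-∀

  mod-+ : ∀ {x y x′ y′} → x ≡ y mod m → x′ ≡ y′ mod m → x + x′ ≡ y + y′ mod m
  mod-+ {y = y} {y′ = y′} (mod-by q refl) (mod-by q′ refl) = mod-by (q + q′) (identity y q y′ q′ m)
    where identity : ∀ y q y′ q′ m → (y + q * m) + (y′ + q′ * m) ≡ (y + y′) + (q + q′) * m
          identity = solve-∀

  mod-* : ∀ {x y x′ y′} → x ≡ y mod m → x′ ≡ y′ mod m → x * x′ ≡ y * y′ mod m
  mod-* {y = y} {y′ = y′} (mod-by q refl) (mod-by q′ refl) =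
    mod-by (q * y′ + y * q′ + q * q′ * m) (identity y q y′ q′ m)
    where identity : ∀ y q y′ q′ m →
                     (y + q * m) * (y′ + q′ * m) ≡ y * y′ + (q * y′ + y * q′ + q * q′ * m) * m
          identity = solve-∀

  mod-neg : ∀ {x y} → x ≡ y mod m → - x ≡ - y mod m
  mod-neg {y = y} (mod-by q refl) = mod-by (- q) (identity y q m)
    where identity : ∀ y q m → - (y + q * m) ≡ - y + (- q) * m
          identity = solve-∀

  mod-- : ∀ {x y x′ y′} → x ≡ y mod m → x′ ≡ y′ mod m → x - x′ ≡ y - y′ mod m
  mod-- x≡y x′≡y′ = mod-+ x≡y (mod-neg x′≡y′)

  mod-*ˡ : ∀ c {x y} → x ≡ y mod m → c * x ≡ c * y mod m
  mod-*ˡ c = mod-* (mod-refl {c})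

  mod-diff : ∀ {x y} → x ≡ y mod m → x - y ≡ + 0 mod m
  mod-diff {x} {y} (mod-by q e) = mod-by q (trans (cong (_- y) e) (identity y q m))
    where identity : ∀ y q m → y + q * m - y ≡ + 0 + q * m
          identity = solve-∀

  diff⇒mod : ∀ {x y} → x - y ≡ + 0 mod m → x ≡ y mod m
  diff⇒mod {x} {y} (mod-by q e) = mod-by q (trans (identity x y) (cong (_+_ y) (trans e (+-identityˡ _))))
    where identity : ∀ x y → x ≡ y + (x - y)
          identity = solve-∀

  ∣⇒≡0-mod : ∀ {z} → m ∣ z → z ≡ + 0 mod m
  ∣⇒≡0-mod m∣z with ℤS.∣ᵤ⇒∣ m∣z
  ... | ℤS.divides q e = mod-by q (trans e (sym (+-identityˡ _)))

  ≡0-mod⇒∣ : ∀ {z} → z ≡ + 0 mod m → m ∣ z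
  ≡0-mod⇒∣ (mod-by q e) = ℤS.∣⇒∣ᵤ (ℤS.divides q (trans e (+-identityˡ _)))

mod-resp-modulus : ∀ {m m′ x y} → m ≡ m′ → x ≡ y mod m → x ≡ y mod m′
mod-resp-modulus refl x≡y = x≡y

cancel-inverse : ∀ {m} w v x → w * v ≡ + 1 mod m → w * (v * x) ≡ x mod m
cancel-inverse w v x wv≡1 =
  mod-trans (≡⇒mod (identity w v x)) (mod-trans (mod-* wv≡1 mod-refl) (≡⇒mod (ℤP.*-identityˡ x)))
  where identity : ∀ w v x → w * (v * x) ≡ (w * v) * x
        identity = solve-∀

≡0-*ˡ : ∀ {m x} c → x ≡ + 0 mod m → c * x ≡ + 0 mod m
≡0-*ˡ c x≡0 = mod-trans (mod-*ˡ c x≡0) (≡⇒mod (ℤP.*-zeroʳ c))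

mod-setoid : ℤ → Setoid 0ℓ 0ℓ
mod-setoid m = record
  { Carrier       = ℤ
  ; _≈_           = λ x y → x ≡ y mod m
  ; isEquivalence = record { refl = mod-refl ; sym = mod-sym ; trans = mod-trans }
  }

module mod-Reasoning (m : ℤ) where
  open import Relation.Binary.Reasoning.Setoid (mod-setoid m) public

mod-1 : ∀ {x y} → x ≡ y mod + 1
mod-1 {x} {y} = mod-by (x - y) (identity x y)
  where identity : ∀ x y → x ≡ y + (x - y) * + 1
        identity = solve-∀

mod-weaken : ∀ {a b x y} → x ≡ y mod a * b → x ≡ y mod a
mod-weaken {a} {b} {y = y} (mod-by q refl) = mod-by (q * b) (cong (_+_ y) (identity q a b))
  where identity : ∀ q a b → q * (a * b) ≡ (q * b) * a
        identity = solve-∀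

mod-*-zero : ∀ {a b x y} → x ≡ + 0 mod a → y ≡ + 0 mod b → x * y ≡ + 0 mod a * b
mod-*-zero {a} {b} (mod-by q refl) (mod-by q′ refl) = mod-by (q * q′) (identity q a q′ b)
  where identity : ∀ q a q′ b → (+ 0 + q * a) * (+ 0 + q′ * b) ≡ + 0 + (q * q′) * (a * b)
        identity = solve-∀

¬2∣⇒≡2h+1 : ∀ n → ¬ 2 ℕD.∣ n → ∃ λ h → n ≡ suc (h ℕ.+ h)
¬2∣⇒≡2h+1 zero 2∤0 = ⊥-elim (2∤0 (ℕD.divides 0 refl))
¬2∣⇒≡2h+1 (suc zero) _ = 0 , refl
¬2∣⇒≡2h+1 (suc (suc n)) 2∤2+n with ¬2∣⇒≡2h+1 n (λ 2∣n → 2∤2+n (ℕD.∣m∣n⇒∣m+n (ℕD.∣-refl {2}) 2∣n))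
... | h , refl = suc h , cong (λ k → suc (suc k)) (sym (ℕP.+-suc h h))

ℕ-eq⇒ℤ : ∀ a b c d e → a ℕ.+ b ℕ.* c ≡ d ℕ.* e → + a + + b * + c ≡ + d * + e
ℕ-eq⇒ℤ a b c d e eq = begin
  + a + + b * + c     ≡⟨ cong (_+_ (+ a)) (sym (pos-* b c)) ⟩
  + a + + (b ℕ.* c)   ≡⟨ sym (pos-+ a (b ℕ.* c)) ⟩
  + (a ℕ.+ b ℕ.* c)   ≡⟨ cong +_ eq ⟩
  + (d ℕ.* e)         ≡⟨ pos-* d e ⟩
  + d * + e           ∎
  where open ≡-Reasoning

module ModPrime {p : ℕ} (p-prime : Prime p) where

  instance
    p≢0 : ℕ.NonZero p
    p≢0 = prime⇒nonZero p-prime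

  P : ℤ
  P = + p

  ≡0⇒p∣ : ∀ {z} → z ≡ + 0 mod P → p ℕD.∣ ∣ z ∣
  ≡0⇒p∣ {z} (mod-by q eq) = ℕD.divides ∣ q ∣ (trans (cong ∣_∣ (trans eq (+-identityˡ (q * P)))) (abs-* q P))

  p∣⇒≡0 : ∀ {z} → p ℕD.∣ ∣ z ∣ → z ≡ + 0 mod P
  p∣⇒≡0 p∣z with ℤS.∣ᵤ⇒∣ {P} p∣z
  ... | ℤS.divides q eq = mod-by q (trans eq (sym (+-identityˡ _)))

  ≡0-mod? : ∀ z → Dec (z ≡ + 0 mod P)
  ≡0-mod? z with p ℕD.∣? ∣ z ∣
  ... | yes p∣z = yes (p∣⇒≡0 p∣z)
  ... | no p∤z = no (λ z≡0 → p∤z (≡0⇒p∣ z≡0))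

  *-≢0 : ∀ {x y} → ¬ x ≡ + 0 mod P → ¬ y ≡ + 0 mod P → ¬ x * y ≡ + 0 mod P
  *-≢0 {x} {y} x≢0 y≢0 xy≡0 with euclidsLemma ∣ x ∣ ∣ y ∣ p-prime (subst (p ℕD.∣_) (abs-* x y) (≡0⇒p∣ xy≡0))
  ... | inj₁ p∣x = x≢0 (p∣⇒≡0 p∣x)
  ... | inj₂ p∣y = y≢0 (p∣⇒≡0 p∣y)

  small-≢0 : ∀ {n} → 0 ℕ.< n → n ℕ.< p → ¬ + n ≡ + 0 mod P
  small-≢0 {suc n} _ n<p n≡0 = ℕP.<⇒≱ n<p (ℕD.∣⇒≤ (≡0⇒p∣ n≡0))

  p>1 : 1 ℕ.< p
  p>1 = ℕ.nonTrivial⇒n>1 p {{prime⇒nonTrivial p-prime}}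

  1≢0 : ¬ + 1 ≡ + 0 mod P
  1≢0 = small-≢0 (ℕ.s≤s ℕ.z≤n) p>1

  2≢0 : p ≢ 2 → ¬ + 2 ≡ + 0 mod P
  2≢0 p≢2 2≡0 = p≢2 (ℕP.≤-antisym (ℕD.∣⇒≤ (≡0⇒p∣ 2≡0)) p>1)

  ∤⇒coprime : ∀ {n} → ¬ p ℕD.∣ n → Coprime n p
  ∤⇒coprime p∤n {d} (d∣n , d∣p) with prime⇒irreducible p-prime d∣p
  ... | inj₁ d≡1 = d≡1
  ... | inj₂ refl = ⊥-elim (p∤n d∣n)

  ℕ-inverse : ∀ n → ¬ p ℕD.∣ n → ∃ λ v → + n * v ≡ + 1 mod P
  ℕ-inverse n p∤n with coprime-Bézout (∤⇒coprime p∤n)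
  ... | Bézout.+- x y eq = + x , mod-by (+ y) (trans (identity (+ n) (+ x)) (sym (ℕ-eq⇒ℤ 1 y p x n eq)))
    where identity : ∀ n x → n * x ≡ x * n
          identity = solve-∀
  ... | Bézout.-+ x y eq = - + x , mod-by (- + y) (identity (+ n) (+ x) (+ y) (ℕ-eq⇒ℤ 1 x n y p eq))
    where identity : ∀ n x y → + 1 + x * n ≡ y * P → n * - x ≡ + 1 + - y * P
          identity n x y eq = trans (ring n x) (trans (cong (λ t → + 1 - t) eq) (ring′ y P))
            where ring : ∀ n x → n * - x ≡ + 1 - (+ 1 + x * n)
                  ring = solve-∀
                  ring′ : ∀ y P → + 1 - y * P ≡ + 1 + - y * P
                  ring′ = solve-∀

  inverse : ∀ {w} → ¬ w ≡ + 0 mod P → ∃ λ v → w * v ≡ + 1 mod P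
  inverse {+ n} w≢0 = ℕ-inverse n (λ p∣n → w≢0 (p∣⇒≡0 p∣n))
  inverse { -[1+ n ]} w≢0 with ℕ-inverse (suc n) (λ p∣n → w≢0 (p∣⇒≡0 p∣n))
  ... | v , nv≡1 = - v , mod-trans (≡⇒mod (identity (+ suc n) v)) nv≡1
    where identity : ∀ n v → (- n) * (- v) ≡ n * v
          identity = solve-∀

  residue : ℤ → Fin p
  residue z = fromℕ< (n%ℕd<d z p)

  residue-injective : ∀ {z z′} → residue z ≡ residue z′ → z ≡ z′ mod P
  residue-injective {z} {z′} eq = mod-by (q - q′) (begin
    z                                       ≡⟨ a≡a%ℕn+[a/ℕn]*n z p ⟩
    + (z %ℕ p) + q * P                      ≡⟨ cong (λ r → + r + q * P) same-remainder ⟩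
    + (z′ %ℕ p) + q * P                     ≡⟨ identity (+ (z′ %ℕ p)) q q′ P ⟩
    (+ (z′ %ℕ p) + q′ * P) + (q - q′) * P   ≡⟨ cong (λ t → t + (q - q′) * P) (sym (a≡a%ℕn+[a/ℕn]*n z′ p)) ⟩
    z′ + (q - q′) * P                       ∎)
    where
      open ≡-Reasoning
      q q′ : ℤ
      q = z /ℕ p
      q′ = z′ /ℕ p
      same-remainder : z %ℕ p ≡ z′ %ℕ p
      same-remainder = trans (sym (toℕ-fromℕ< (n%ℕd<d z p))) (trans (cong toℕ eq) (toℕ-fromℕ< (n%ℕd<d z′ p)))
      identity : ∀ r q q′ P → r + q * P ≡ (r + q′ * P) + (q - q′) * P
      identity = solve-∀

module OddPrime {p : ℕ} (p-prime : Prime p) (p≢2 : p ≢ 2) where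

  open ModPrime p-prime

  private
    p≡2h+1 : ∃ λ h → p ≡ suc (h ℕ.+ h)
    p≡2h+1 = ¬2∣⇒≡2h+1 p λ 2∣p → p≢2 (≡-irreducible (prime⇒irreducible p-prime 2∣p))
      where ≡-irreducible : 2 ≡ 1 ⊎ 2 ≡ p → p ≡ 2
            ≡-irreducible (inj₂ 2≡p) = sym 2≡p

    h : ℕ
    h = proj₁ p≡2h+1

  squares-differ : ∀ {γ a b} → ¬ γ ≡ + 0 mod P → a ℕ.< b → b ℕ.≤ h →
                   ¬ γ * (+ a * + a) ≡ γ * (+ b * + b) mod P
  squares-differ {γ} {a} {b} γ≢0 a<b b≤h γa²≡γb² =
    *-≢0 γ≢0 (*-≢0 (small-≢0 0<b-a b-a<p) (small-≢0 0<b+a b+a<p)) factored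
    where
      identity : ∀ γ a b → γ * ((b - a) * (b + a)) ≡ γ * (b * b) - γ * (a * a)
      identity = solve-∀
      b-a≡ : + (b ℕ.∸ a) ≡ + b - + a
      b-a≡ = sym (trans (ℤP.m-n≡m⊖n b a) (ℤP.⊖-≥ (ℕP.<⇒≤ a<b)))
      factored : γ * (+ (b ℕ.∸ a) * + (b ℕ.+ a)) ≡ + 0 mod P
      factored = mod-trans (≡⇒mod (trans (cong₂ (λ d s → γ * (d * s)) b-a≡ (pos-+ b a)) (identity γ (+ a) (+ b))))
                           (mod-diff (mod-sym γa²≡γb²))
      a≤h : a ℕ.≤ h
      a≤h = ℕP.≤-trans (ℕP.<⇒≤ a<b) b≤h
      b<p : b ℕ.< p
      b<p = subst (b ℕ.<_) (sym (proj₂ p≡2h+1)) (ℕ.s≤s (ℕP.≤-trans b≤h (ℕP.m≤m+n h h)))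
      0<b-a : 0 ℕ.< b ℕ.∸ a
      0<b-a = ℕP.m<n⇒0<n∸m a<b
      b-a<p : b ℕ.∸ a ℕ.< p
      b-a<p = ℕP.≤-<-trans (ℕP.m∸n≤m b a) b<p
      0<b+a : 0 ℕ.< b ℕ.+ a
      0<b+a = ℕP.<-≤-trans (ℕP.<-≤-trans (ℕ.s≤s ℕ.z≤n) a<b) (ℕP.m≤m+n b a)
      b+a<p : b ℕ.+ a ℕ.< p
      b+a<p = subst (b ℕ.+ a ℕ.<_) (sym (proj₂ p≡2h+1)) (ℕ.s≤s (ℕP.+-mono-≤ b≤h a≤h))

  square-injective : ∀ {γ} → ¬ γ ≡ + 0 mod P → (s t : Fin (suc h)) →
                     γ * (+ toℕ s * + toℕ s) ≡ γ * (+ toℕ t * + toℕ t) mod P → s ≡ t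
  square-injective γ≢0 s t eq with <-cmp s t
  ... | tri< s<t _ _ = ⊥-elim (squares-differ γ≢0 s<t (ℕ.s≤s⁻¹ (toℕ<n t)) eq)
  ... | tri≈ _ s≡t _ = s≡t
  ... | tri> _ _ t<s = ⊥-elim (squares-differ γ≢0 t<s (ℕ.s≤s⁻¹ (toℕ<n s)) (mod-sym eq))

  -- The p + 1 values α s² and M − β t² (0 ≤ s, t ≤ (p − 1) / 2) must collide modulo p.
  sum-of-two-squares : ∀ {α β} → ¬ α ≡ + 0 mod P → ¬ β ≡ + 0 mod P → ∀ M →
                       ∃₂ λ s t → α * (s * s) + β * (t * t) ≡ M mod P
  sum-of-two-squares {α} {β} α≢0 β≢0 M =
    let i , j , i<j , same = pigeonhole p<h+h+2 (λ i → residue (value (splitAt (suc h) i)))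
    in collide (splitAt (suc h) i) (splitAt (suc h) j) (λ e → <⇒≢ i<j (splitAt-injective e)) (residue-injective same)
    where
      splitAt-injective : ∀ {i j} → splitAt (suc h) i ≡ splitAt (suc h) j → i ≡ j
      splitAt-injective {i} {j} e = trans (sym (join-splitAt (suc h) (suc h) i))
                                    (trans (cong (join (suc h) (suc h)) e) (join-splitAt (suc h) (suc h) j))

      value : Fin (suc h) ⊎ Fin (suc h) → ℤ
      value (inj₁ s) = α * (+ toℕ s * + toℕ s)
      value (inj₂ t) = M - β * (+ toℕ t * + toℕ t)

      p<h+h+2 : p ℕ.< suc h ℕ.+ suc h
      p<h+h+2 = subst (ℕ._< suc h ℕ.+ suc h) (sym (proj₂ p≡2h+1)) (ℕ.s≤s (ℕP.+-monoʳ-< h (ℕP.n<1+n h)))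

      cancel : ∀ {x y} → M - x ≡ M - y mod P → x ≡ y mod P
      cancel {x} {y} eq =
        mod-trans (≡⇒mod (sym (identity M x))) (mod-trans (mod-- (mod-refl {x = M}) eq) (≡⇒mod (identity M y)))
        where identity : ∀ M x → M - (M - x) ≡ x
              identity = solve-∀

      solution : ∀ {x y} → x ≡ M - y mod P → x + y ≡ M mod P
      solution {x} {y} eq = mod-trans (mod-+ eq (mod-refl {x = y})) (≡⇒mod (identity M y))
        where identity : ∀ M y → (M - y) + y ≡ M
              identity = solve-∀

      collide : ∀ u v → u ≢ v → value u ≡ value v mod P →
                ∃₂ λ s t → α * (s * s) + β * (t * t) ≡ M mod P
      collide (inj₁ s) (inj₁ s′) u≢v eq = ⊥-elim (u≢v (cong inj₁ (square-injective α≢0 s s′ eq)))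
      collide (inj₁ s) (inj₂ t) _ eq = + toℕ s , + toℕ t , solution eq
      collide (inj₂ t) (inj₁ s) _ eq = + toℕ s , + toℕ t , solution (mod-sym eq)
      collide (inj₂ t) (inj₂ t′) u≢v eq = ⊥-elim (u≢v (cong inj₂ (square-injective β≢0 t t′ (cancel eq))))

  -- 2 u₀ = (u₀ + u₁) + (u₀ + u₂) − (u₁ + u₂), so one of these three sums is a unit.
  unit-sum-first : (u : Fin 5 → ℤ) → ¬ u zero ≡ + 0 mod P →
    ∃ λ (π : Permutation′ 5) → ¬ u (π ⟨$⟩ʳ zero) + u (π ⟨$⟩ʳ suc zero) ≡ + 0 mod P
  unit-sum-first u u₀≢0 with ≡0-mod? (u zero + u (suc zero)) | ≡0-mod? (u zero + u (suc (suc zero)))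
  ... | no u₀₁≢0 | _ = Perm.id , u₀₁≢0
  ... | yes _ | no u₀₂≢0 = transpose (suc zero) (suc (suc zero)) , u₀₂≢0
  ... | yes u₀₁≡0 | yes u₀₂≡0 = transpose (suc zero) (suc (suc zero)) ∘ₚ transpose zero (suc zero) , λ u₁₂≡0 →
          *-≢0 (2≢0 p≢2) u₀≢0 (mod-trans (≡⇒mod (identity (u zero) (u (suc zero)) (u (suc (suc zero)))))
                                          (mod-- (mod-+ u₀₁≡0 u₀₂≡0) u₁₂≡0))
    where identity : ∀ a b c → + 2 * a ≡ (a + b) + (a + c) - (b + c)
          identity = solve-∀

  record DiagonalSolution (v₀ v₁ v₂ v₃ c N : ℤ) : Set where
    field
      z₀ z₁ z₂ z₃ : ℤ
      linear      : v₀ * z₀ + v₁ * z₁ + v₂ * z₂ + v₃ * z₃ ≡ c mod P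
      quadratic   : v₀ * (z₀ * z₀) + v₁ * (z₁ * z₁) + v₂ * (z₂ * z₂) + v₃ * (z₃ * z₃) ≡ N mod P
      z₀≢0        : ¬ z₀ ≡ + 0 mod P

  paired-solution : ∀ {v₀ v₁ v₂ v₃ c N} r σ r′ τ →
    (v₀ + v₁) * r + (v₂ + v₃) * r′ ≡ c mod P →
    (v₀ + v₁) * (r * r) + (v₂ + v₃) * (r′ * r′)
      + (v₀ * v₁ * (v₀ + v₁) * (σ * σ) + v₂ * v₃ * (v₂ + v₃) * (τ * τ)) ≡ N mod P →
    ¬ r + v₁ * σ ≡ + 0 mod P → DiagonalSolution v₀ v₁ v₂ v₃ c N
  paired-solution {v₀} {v₁} {v₂} {v₃} r σ r′ τ lin quad z₀≢0 = record
    { z₀ = r + v₁ * σ ; z₁ = r - v₀ * σ ; z₂ = r′ + v₃ * τ ; z₃ = r′ - v₂ * τ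
    ; linear    = mod-trans (≡⇒mod (linear-identity v₀ v₁ v₂ v₃ r σ r′ τ)) lin
    ; quadratic = mod-trans (≡⇒mod (quadratic-identity v₀ v₁ v₂ v₃ r σ r′ τ)) quad
    ; z₀≢0      = z₀≢0
    }
    where
      linear-identity : ∀ v₀ v₁ v₂ v₃ r σ r′ τ →
        v₀ * (r + v₁ * σ) + v₁ * (r - v₀ * σ) + v₂ * (r′ + v₃ * τ) + v₃ * (r′ - v₂ * τ)
          ≡ (v₀ + v₁) * r + (v₂ + v₃) * r′
      linear-identity = solve-∀
      quadratic-identity : ∀ v₀ v₁ v₂ v₃ r σ r′ τ →
        v₀ * ((r + v₁ * σ) * (r + v₁ * σ)) + v₁ * ((r - v₀ * σ) * (r - v₀ * σ))
          + v₂ * ((r′ + v₃ * τ) * (r′ + v₃ * τ)) + v₃ * ((r′ - v₂ * τ) * (r′ - v₂ * τ))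
          ≡ (v₀ + v₁) * (r * r) + (v₂ + v₃) * (r′ * r′)
            + (v₀ * v₁ * (v₀ + v₁) * (σ * σ) + v₂ * v₃ * (v₂ + v₃) * (τ * τ))
      quadratic-identity = solve-∀

  sign-choice : ∀ {r} v σ → ¬ r ≡ + 0 mod P → ∃ λ σ′ → σ′ * σ′ ≡ σ * σ × ¬ (r + v * σ′ ≡ + 0 mod P)
  sign-choice {r} v σ r≢0 with ≡0-mod? (r + v * σ)
  ... | no ≢0 = σ , refl , ≢0
  ... | yes ≡0 = - σ , square-neg σ , λ ≡0′ →
          *-≢0 (2≢0 p≢2) r≢0 (mod-trans (≡⇒mod (sum-identity r v σ)) (mod-+ ≡0 ≡0′))
    where
      square-neg : ∀ σ → - σ * - σ ≡ σ * σ
      square-neg = solve-∀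
      sum-identity : ∀ r v σ → + 2 * r ≡ (r + v * σ) + (r + v * - σ)
      sum-identity = solve-∀

  solution-when-v₂+v₃≢0 : ∀ {v₀ v₁ v₂ v₃} →
    ¬ v₀ ≡ + 0 mod P → ¬ v₁ ≡ + 0 mod P → ¬ v₂ ≡ + 0 mod P → ¬ v₃ ≡ + 0 mod P →
    ¬ v₀ + v₁ ≡ + 0 mod P → ¬ v₂ + v₃ ≡ + 0 mod P → ∀ c N → DiagonalSolution v₀ v₁ v₂ v₃ c N
  solution-when-v₂+v₃≢0 {v₀} {v₁} {v₂} {v₃} v₀≢0 v₁≢0 v₂≢0 v₃≢0 u≢0 w≢0 c N =
    paired-solution (+ 1) σ′ r′ τ lin
      (subst (λ s → A + (α * s + β * (τ * τ)) ≡ N mod P) (sym σ′²≡σ²) quad) z₀≢0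
    where
      open mod-Reasoning P
      u w α β ι r′ A : ℤ
      u = v₀ + v₁
      w = v₂ + v₃
      α = v₀ * v₁ * u
      β = v₂ * v₃ * w
      ι = proj₁ (inverse w≢0)
      r′ = ι * (c - u)
      A = u * (+ 1 * + 1) + w * (r′ * r′)

      squares : ∃₂ λ σ τ → α * (σ * σ) + β * (τ * τ) ≡ N - A mod P
      squares = sum-of-two-squares (*-≢0 (*-≢0 v₀≢0 v₁≢0) u≢0) (*-≢0 (*-≢0 v₂≢0 v₃≢0) w≢0) (N - A)
      σ τ : ℤ
      σ = proj₁ squares
      τ = proj₁ (proj₂ squares)

      lin : u * + 1 + w * r′ ≡ c mod P
      lin = begin
        u * + 1 + w * (ι * (c - u))  ≈⟨ mod-+ (mod-refl {x = u * + 1}) (cancel-inverse w ι (c - u) (proj₂ (inverse w≢0))) ⟩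
        u * + 1 + (c - u)            ≡⟨ identity u c ⟩
        c                            ∎
        where identity : ∀ u c → u * + 1 + (c - u) ≡ c
              identity = solve-∀

      quad : A + (α * (σ * σ) + β * (τ * τ)) ≡ N mod P
      quad = mod-trans (mod-+ (mod-refl {x = A}) (proj₂ (proj₂ squares))) (≡⇒mod (identity A N))
        where identity : ∀ A N → A + (N - A) ≡ N
              identity = solve-∀

      σ′-choice : ∃ λ σ′ → σ′ * σ′ ≡ σ * σ × ¬ (+ 1 + v₁ * σ′ ≡ + 0 mod P)
      σ′-choice = sign-choice v₁ σ 1≢0
      σ′ : ℤ
      σ′ = proj₁ σ′-choice
      σ′²≡σ² : σ′ * σ′ ≡ σ * σ
      σ′²≡σ² = proj₁ (proj₂ σ′-choice)
      z₀≢0 : ¬ + 1 + v₁ * σ′ ≡ + 0 mod P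
      z₀≢0 = proj₂ (proj₂ σ′-choice)

  -- (r, r, z + δ, z) with v₂ + v₃ ≡ 0 turns the quadratic equation into a linear one in z.
  solution-when-v₂+v₃≡0 : ∀ {v₀ v₁ v₂ v₃} → ¬ v₂ ≡ + 0 mod P →
    ¬ v₀ + v₁ ≡ + 0 mod P → v₂ + v₃ ≡ + 0 mod P → ∀ c N → DiagonalSolution v₀ v₁ v₂ v₃ c N
  solution-when-v₂+v₃≡0 {v₀} {v₁} {v₂} {v₃} v₂≢0 u≢0 w≡0 c N = record
    { z₀ = r ; z₁ = r ; z₂ = z + δ ; z₃ = z
    ; linear = begin
        v₀ * r + v₁ * r + v₂ * (z + δ) + v₃ * z  ≡⟨ linear-identity v₀ v₁ v₂ v₃ r z δ ⟩
        (v₀ + v₁) * r + (v₂ + v₃) * z + v₂ * δ   ≈⟨ mod-+ (mod-+ ur≡X (mod-* w≡0 (mod-refl {x = z}))) (mod-refl {x = v₂ * δ}) ⟩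
        X + + 0 * z + v₂ * δ                     ≡⟨ identity₁ c v₂ δ z ⟩
        c                                        ∎
    ; quadratic = begin
        v₀ * (r * r) + v₁ * (r * r) + v₂ * ((z + δ) * (z + δ)) + v₃ * (z * z)
          ≡⟨ quadratic-identity v₀ v₁ v₂ v₃ r z δ ⟩
        (v₀ + v₁) * (r * r) + (v₂ + v₃) * (z * z) + (+ 2 * v₂ * δ) * z + v₂ * (δ * δ)
          ≈⟨ mod-+ (mod-+ (mod-+ (mod-refl {x = (v₀ + v₁) * (r * r)}) (mod-* w≡0 (mod-refl {x = z * z})))
                          (cancel-inverse (+ 2 * v₂ * δ) (proj₁ κ-inverse) R (proj₂ κ-inverse)))
                   (mod-refl {x = v₂ * (δ * δ)}) ⟩
        (v₀ + v₁) * (r * r) + + 0 * (z * z) + R + v₂ * (δ * δ)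
          ≡⟨ identity₂ ((v₀ + v₁) * (r * r)) z N (v₂ * (δ * δ)) ⟩
        N ∎
    ; z₀≢0 = λ r≡0 → X≢0 (mod-trans (mod-sym ur≡X) (≡0-*ˡ (v₀ + v₁) r≡0))
    }
    where
      open mod-Reasoning P

      shift-choice : ∃ λ δ → ¬ (c - v₂ * δ ≡ + 0 mod P) × ¬ (δ ≡ + 0 mod P)
      shift-choice with ≡0-mod? (c - v₂ * + 1)
      ... | no ≢0 = + 1 , ≢0 , 1≢0
      ... | yes ≡0 = + 2 , (λ ≡0′ → v₂≢0 (mod-trans (≡⇒mod (identity c v₂)) (mod-- ≡0 ≡0′))) , 2≢0 p≢2
        where identity : ∀ c v → v ≡ (c - v * + 1) - (c - v * + 2)
              identity = solve-∀

      δ X r R z : ℤ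
      δ = proj₁ shift-choice
      X = c - v₂ * δ
      r = proj₁ (inverse u≢0) * X
      R = N - (v₀ + v₁) * (r * r) - v₂ * (δ * δ)
      κ-inverse : ∃ λ κ → + 2 * v₂ * δ * κ ≡ + 1 mod P
      κ-inverse = inverse (*-≢0 (*-≢0 (2≢0 p≢2) v₂≢0) (proj₂ (proj₂ shift-choice)))
      z = proj₁ κ-inverse * R

      X≢0 : ¬ X ≡ + 0 mod P
      X≢0 = proj₁ (proj₂ shift-choice)
      ur≡X : (v₀ + v₁) * r ≡ X mod P
      ur≡X = cancel-inverse (v₀ + v₁) (proj₁ (inverse u≢0)) X (proj₂ (inverse u≢0))

      linear-identity : ∀ v₀ v₁ v₂ v₃ r z δ →
        v₀ * r + v₁ * r + v₂ * (z + δ) + v₃ * z ≡ (v₀ + v₁) * r + (v₂ + v₃) * z + v₂ * δ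
      linear-identity = solve-∀
      identity₁ : ∀ c v δ z → (c - v * δ) + + 0 * z + v * δ ≡ c
      identity₁ = solve-∀
      quadratic-identity : ∀ v₀ v₁ v₂ v₃ r z δ →
        v₀ * (r * r) + v₁ * (r * r) + v₂ * ((z + δ) * (z + δ)) + v₃ * (z * z)
          ≡ (v₀ + v₁) * (r * r) + (v₂ + v₃) * (z * z) + (+ 2 * v₂ * δ) * z + v₂ * (δ * δ)
      quadratic-identity = solve-∀
      identity₂ : ∀ A z N B → A + + 0 * (z * z) + (N - A - B) + B ≡ N
      identity₂ = solve-∀

  diagonal-solution : ∀ {v₀ v₁ v₂ v₃} →
    ¬ v₀ ≡ + 0 mod P → ¬ v₁ ≡ + 0 mod P → ¬ v₂ ≡ + 0 mod P → ¬ v₃ ≡ + 0 mod P →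
    ¬ v₀ + v₁ ≡ + 0 mod P → ∀ c N → DiagonalSolution v₀ v₁ v₂ v₃ c N
  diagonal-solution {v₂ = v₂} {v₃} v₀≢0 v₁≢0 v₂≢0 v₃≢0 u≢0 with ≡0-mod? (v₂ + v₃)
  ... | yes w≡0 = solution-when-v₂+v₃≡0 v₂≢0 u≢0 w≡0
  ... | no w≢0 = solution-when-v₂+v₃≢0 v₀≢0 v₁≢0 v₂≢0 v₃≢0 u≢0 w≢0

module PAdic (p : ℕ) where

  P^_ : ℕ → ℤ
  P^ k = + (p ^ k)

  P^1≡p : P^ 1 ≡ + p
  P^1≡p = cong +_ (ℕP.*-identityʳ p)

  P^suc : ∀ k → P^ suc k ≡ + p * P^ k
  P^suc k = pos-* p (p ^ k)

  P^suc-square : ∀ j → P^ suc j * P^ suc j ≡ P^ suc (suc j) * P^ j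
  P^suc-square j = begin
    P^ suc j * P^ suc j               ≡⟨ sym (pos-* (p ^ suc j) (p ^ suc j)) ⟩
    + (p ^ suc j ℕ.* p ^ suc j)       ≡⟨ cong +_ (sym (ℕP.^-distribˡ-+-* p (suc j) (suc j))) ⟩
    + (p ^ (suc j ℕ.+ suc j))         ≡⟨ cong (λ e → + (p ^ e)) (ℕP.+-suc (suc j) j) ⟩
    + (p ^ (suc (suc j) ℕ.+ j))       ≡⟨ cong +_ (ℕP.^-distribˡ-+-* p (suc (suc j)) j) ⟩
    + (p ^ suc (suc j) ℕ.* p ^ j)     ≡⟨ pos-* (p ^ suc (suc j)) (p ^ j) ⟩
    P^ suc (suc j) * P^ j             ∎
    where open ≡-Reasoning

  mod-P^suc⇒mod-p : ∀ k {x y} → x ≡ y mod P^ suc k → x ≡ y mod + p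
  mod-P^suc⇒mod-p k x≡y = mod-weaken (mod-resp-modulus (P^suc k) x≡y)

  constant : ℤ → ℤₚ p
  constant z = mkℤₚ (λ _ → z) (λ k → ≡0-mod⇒∣ (mod-diff (mod-refl {P^ k} {z})))

  res-compat : ∀ (x : ℤₚ p) k → res x (suc k) ≡ res x k mod P^ k
  res-compat x k = diff⇒mod (∣⇒≡0-mod {P^ k} {res x (suc k) - res x k} (compat x k))

  res≡res₁ : ∀ (x : ℤₚ p) k → res x (suc k) ≡ res x 1 mod + p
  res≡res₁ x zero = mod-refl
  res≡res₁ x (suc k) = mod-trans (mod-P^suc⇒mod-p k (res-compat x (suc k))) (res≡res₁ x k)

  ∈pℤₚ⇒res₁≡0 : ∀ {x : ℤₚ p} → In-pℤₚ x → res x 1 ≡ + 0 mod + p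
  ∈pℤₚ⇒res₁≡0 {x} (y , x≡py) =
    mod-trans (diff⇒mod (mod-resp-modulus P^1≡p (∣⇒≡0-mod {P^ 1} {res x 1 - + p * res y 1} (x≡py 1))))
              (mod-by (res y 1) (identity (+ p) (res y 1)))
    where identity : ∀ p y → p * y ≡ + 0 + y * p
          identity = solve-∀

  unit-inverse : ∀ {z} → (u : IsUnitℤₚ p z) → ∀ k → z * res (proj₁ u) k ≡ + 1 mod P^ k
  unit-inverse {z} (y , zy≡1) k = diff⇒mod (∣⇒≡0-mod {P^ k} {z * res y k - + 1} (zy≡1 k))

  unit⇒≢0 : Prime p → ∀ {z} → IsUnitℤₚ p z → ¬ z ≡ + 0 mod + p
  unit⇒≢0 p-prime {z} u z≡0 = ModPrime.1≢0 p-prime (begin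
    + 1              ≈⟨ mod-sym (mod-resp-modulus P^1≡p (unit-inverse {z} u 1)) ⟩
    z * res y 1      ≈⟨ mod-* z≡0 (mod-refl {x = res y 1}) ⟩
    + 0 * res y 1    ≡⟨ ℤP.*-zeroˡ (res y 1) ⟩
    + 0              ∎)
    where open mod-Reasoning (+ p)
          y : ℤₚ p
          y = proj₁ u

  -- Newton iteration with the derivative inverted once and for all modulo p; the family f is
  -- indexed by the level k, as the coefficients of the equation are themselves p-adic.
  module Hensel (f D : ℕ → ℤ → ℤ) (α t₀ w : ℤ)
    (f-compat  : ∀ k t → f (suc k) t ≡ f k t mod P^ k)
    (taylor    : ∀ k t d → f k (t + d) ≡ f k t + D k t * d + α * (d * d))
    (D-inverse : ∀ k t → t ≡ t₀ mod + p → D (suc k) t * w ≡ + 1 mod + p)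
    (root₁     : f 1 t₀ ≡ + 0 mod + p)
    where

    newton-step : ∀ j t → t ≡ t₀ mod + p → f (suc j) t ≡ + 0 mod P^ suc j →
                  f (suc (suc j)) (t - w * f (suc (suc j)) t) ≡ + 0 mod P^ suc (suc j)
    newton-step j t t≡t₀ root = begin
      f (suc (suc j)) (t - w * F)                       ≡⟨ taylor (suc (suc j)) t (- (w * F)) ⟩
      F + Dₜ * - (w * F) + α * (- (w * F) * - (w * F))  ≡⟨ identity F Dₜ w α ⟩
      (+ 1 - Dₜ * w) * F + α * w * w * (F * F)          ≈⟨ mod-+ linear-term (≡0-*ˡ (α * w * w) quadratic-term) ⟩
      + 0                                               ∎
      where
        open mod-Reasoning (P^ suc (suc j))
        F Dₜ : ℤ
        F = f (suc (suc j)) t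
        Dₜ = D (suc (suc j)) t
        identity : ∀ F D w α → F + D * - (w * F) + α * (- (w * F) * - (w * F)) ≡ (+ 1 - D * w) * F + α * w * w * (F * F)
        identity = solve-∀
        F≡0 : F ≡ + 0 mod P^ suc j
        F≡0 = mod-trans (f-compat (suc j) t) root
        linear-term : (+ 1 - Dₜ * w) * F ≡ + 0 mod P^ suc (suc j)
        linear-term = mod-resp-modulus (sym (P^suc (suc j)))
                        (mod-*-zero (mod-diff (mod-sym (D-inverse (suc j) t t≡t₀))) F≡0)
        quadratic-term : F * F ≡ + 0 mod P^ suc (suc j)
        quadratic-term = mod-weaken {b = P^ j} (mod-resp-modulus (P^suc-square j) (mod-*-zero F≡0 F≡0))

    approximation : ℕ → ℤ
    approximation zero = t₀
    approximation (suc j) = approximation j - w * f (suc (suc j)) (approximation j)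

    correction-small : ∀ j → f (suc j) (approximation j) ≡ + 0 mod P^ suc j →
                       approximation (suc j) ≡ approximation j mod P^ suc j
    correction-small j root = mod-trans (mod-- (mod-refl {x = t}) (≡0-*ˡ w (mod-trans (f-compat (suc j) t) root)))
                                        (≡⇒mod (ℤP.+-identityʳ t))
      where t : ℤ
            t = approximation j

    approximation-invariant : ∀ j → approximation j ≡ t₀ mod + p × f (suc j) (approximation j) ≡ + 0 mod P^ suc j
    approximation-invariant zero = mod-refl , mod-resp-modulus (sym P^1≡p) root₁
    approximation-invariant (suc j) =
      let t≡t₀ , root = approximation-invariant j
      in  mod-trans (mod-P^suc⇒mod-p j (correction-small j root)) t≡t₀ , newton-step j (approximation j) t≡t₀ root

    root-sequence : ℕ → ℤ
    root-sequence zero = t₀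
    root-sequence (suc j) = approximation j

    root : ℤₚ p
    root = mkℤₚ root-sequence compatible
      where compatible : ∀ k → P^ k ∣ (root-sequence (suc k) - root-sequence k)
            compatible zero = ≡0-mod⇒∣ (mod-1 {approximation 0 - t₀} {+ 0})
            compatible (suc j) = ≡0-mod⇒∣ (mod-diff (correction-small j (proj₂ (approximation-invariant j))))

    root-is-root : ∀ k → f k (res root k) ≡ + 0 mod P^ k
    root-is-root zero = mod-1
    root-is-root (suc j) = proj₂ (approximation-invariant j)

    root≡t₀ : ∀ k → res root k ≡ t₀ mod + p
    root≡t₀ zero = mod-refl
    root≡t₀ (suc j) = proj₁ (approximation-invariant j)

Σℤ-cong : ∀ r {f g : Fin r → ℤ} → (∀ i → f i ≡ g i) → Σℤ r f ≡ Σℤ r g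
Σℤ-cong zero f≡g = refl
Σℤ-cong (suc r) f≡g = cong₂ _+_ (f≡g zero) (Σℤ-cong r (λ i → f≡g (suc i)))

Σℤ-*ˡ : ∀ r c (g : Fin r → ℤ) → Σℤ r (λ i → c * g i) ≡ c * Σℤ r g
Σℤ-*ˡ zero c g = sym (ℤP.*-zeroʳ c)
Σℤ-*ˡ (suc r) c g = trans (cong (_+_ (c * g zero)) (Σℤ-*ˡ r c (λ i → g (suc i))))
                          (sym (ℤP.*-distribˡ-+ c (g zero) (Σℤ r (λ i → g (suc i)))))

Σℤ-zero : ∀ r (f : Fin r → ℤ) → (∀ i → f i ≡ + 0) → Σℤ r f ≡ + 0
Σℤ-zero zero f f≡0 = refl
Σℤ-zero (suc r) f f≡0 = cong₂ _+_ (f≡0 zero) (Σℤ-zero r (λ i → f (suc i)) (λ i → f≡0 (suc i)))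

Σℤ-split : ∀ r (f g : Fin r → ℤ) e → (∀ i → i ≢ e → f i ≡ g i) → g e ≡ + 0 → Σℤ r f ≡ f e + Σℤ r g
Σℤ-split (suc r) f g zero f≡g g₀≡0 = cong (_+_ (f zero)) (begin
  Σℤ r (λ i → f (suc i))              ≡⟨ Σℤ-cong r (λ i → f≡g (suc i) (λ ())) ⟩
  Σℤ r (λ i → g (suc i))              ≡⟨ sym (+-identityˡ _) ⟩
  + 0 + Σℤ r (λ i → g (suc i))        ≡⟨ cong (λ z → z + Σℤ r (λ i → g (suc i))) (sym g₀≡0) ⟩
  g zero + Σℤ r (λ i → g (suc i))     ∎)
  where open ≡-Reasoning
Σℤ-split (suc r) f g (suc e) f≡g gₑ≡0 = begin
  f zero + Σℤ r (λ i → f (suc i))                  ≡⟨ cong₂ _+_ (f≡g zero (λ ())) (Σℤ-split r (λ i → f (suc i)) (λ i → g (suc i)) e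
                                                        (λ i i≢e → f≡g (suc i) (λ eq → i≢e (FinP.suc-injective eq))) gₑ≡0) ⟩
  g zero + (f (suc e) + Σℤ r (λ i → g (suc i)))    ≡⟨ identity (g zero) (f (suc e)) (Σℤ r (λ i → g (suc i))) ⟩
  f (suc e) + (g zero + Σℤ r (λ i → g (suc i)))    ∎
  where open ≡-Reasoning
        identity : ∀ a b c → a + (b + c) ≡ b + (a + c)
        identity = solve-∀

extend : ∀ {m r} {A : Set} → A → (Fin m → Fin r) → (Fin m → A) → Fin r → A
extend {zero} d T y i = d
extend {suc m} d T y i with i Fin.≟ T zero
... | yes _ = y zero
... | no _ = extend d (λ t → T (suc t)) (λ t → y (suc t)) i

map-extend : ∀ {m r} {A B : Set} (g : A → B) d (T : Fin m → Fin r) y i →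
             g (extend d T y i) ≡ extend (g d) T (λ t → g (y t)) i
map-extend {zero} g d T y i = refl
map-extend {suc m} g d T y i with i Fin.≟ T zero
... | yes _ = refl
... | no _ = map-extend g d (λ t → T (suc t)) (λ t → y (suc t)) i

extend-outside : ∀ {m r} {A : Set} d (T : Fin m → Fin r) (y : Fin m → A) i → (∀ t → T t ≢ i) → extend d T y i ≡ d
extend-outside {zero} d T y i _ = refl
extend-outside {suc m} d T y i T≢i with i Fin.≟ T zero
... | yes i≡T₀ = ⊥-elim (T≢i zero (sym i≡T₀))
... | no _ = extend-outside d (λ t → T (suc t)) (λ t → y (suc t)) i (λ t → T≢i (suc t))

extend-at : ∀ {m r} {A : Set} d (T : Fin m → Fin r) (y : Fin m → A) → Injective _≡_ _≡_ T → ∀ t → extend d T y (T t) ≡ y t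
extend-at {suc m} d T y T-injective zero with T zero Fin.≟ T zero
... | yes _ = refl
... | no T₀≢T₀ = ⊥-elim (T₀≢T₀ refl)
extend-at {suc m} d T y T-injective (suc t) with T (suc t) Fin.≟ T zero
... | yes Tₜ≡T₀ = ⊥-elim (FinP.0≢1+n (sym (T-injective Tₜ≡T₀)))
... | no _ = extend-at d (λ t → T (suc t)) (λ t → y (suc t)) (λ eq → FinP.suc-injective (T-injective eq)) t

Σℤ-extend : ∀ {m r} (h : Fin r → ℤ → ℤ) → (∀ i → h i (+ 0) ≡ + 0) → (T : Fin m → Fin r) → Injective _≡_ _≡_ T →
            (y : Fin m → ℤ) → Σℤ r (λ i → h i (extend (+ 0) T y i)) ≡ Σℤ m (λ t → h (T t) (y t))
Σℤ-extend {zero} {r} h h0≡0 T T-injective y = Σℤ-zero r _ h0≡0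
Σℤ-extend {suc m} {r} h h0≡0 T T-injective y = begin
  Σℤ r (λ i → h i (extend (+ 0) T y i))
    ≡⟨ Σℤ-split r _ (λ i → h i (extend (+ 0) T′ y′ i)) (T zero) agree-off-T₀ vanish-at-T₀ ⟩
  h (T zero) (extend (+ 0) T y (T zero)) + Σℤ r (λ i → h i (extend (+ 0) T′ y′ i))
    ≡⟨ cong₂ _+_ (cong (h (T zero)) (extend-at (+ 0) T y T-injective zero))
                 (Σℤ-extend h h0≡0 T′ (λ eq → FinP.suc-injective (T-injective eq)) y′) ⟩
  h (T zero) (y zero) + Σℤ m (λ t → h (T′ t) (y′ t)) ∎
  where
    open ≡-Reasoning
    T′ : Fin m → Fin r
    T′ t = T (suc t)
    y′ : Fin m → ℤ
    y′ t = y (suc t)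
    agree-off-T₀ : ∀ i → i ≢ T zero → h i (extend (+ 0) T y i) ≡ h i (extend (+ 0) T′ y′ i)
    agree-off-T₀ i i≢T₀ with i Fin.≟ T zero
    ... | yes i≡T₀ = ⊥-elim (i≢T₀ i≡T₀)
    ... | no _ = refl
    vanish-at-T₀ : h (T zero) (extend (+ 0) T′ y′ (T zero)) ≡ + 0
    vanish-at-T₀ = trans (cong (h (T zero)) (extend-outside (+ 0) T′ y′ (T zero) (λ t eq → FinP.0≢1+n (sym (T-injective eq)))))
                         (h0≡0 (T zero))

eliminate-last : ∀ {M} v ι c N S Q y → v * ι ≡ + 1 mod M → v * y ≡ c - S mod M →
  (c - S) * (c - S) + v * Q - v * N ≡ + 0 mod M →
  S + v * y ≡ c mod M × Q + v * (y * y) ≡ N mod M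
eliminate-last {M} v ι c N S Q y vι≡1 vy≡c-S f≡0 = linear , diff⇒mod quadratic
  where
    open mod-Reasoning M
    linear : S + v * y ≡ c mod M
    linear = mod-trans (mod-+ (mod-refl {x = S}) vy≡c-S) (≡⇒mod (identity₁ S c))
      where identity₁ : ∀ S c → S + (c - S) ≡ c
            identity₁ = solve-∀
    quadratic : Q + v * (y * y) - N ≡ + 0 mod M
    quadratic = begin
      Q + v * (y * y) - N                              ≈⟨ mod-sym (cancel-inverse v ι _ vι≡1) ⟩
      v * (ι * (Q + v * (y * y) - N))                  ≡⟨ identity₂ v ι Q y N ⟩
      ι * (v * Q + (v * y) * (v * y) - v * N)          ≈⟨ mod-*ˡ ι (mod-- (mod-+ (mod-refl {x = v * Q}) (mod-* vy≡c-S vy≡c-S)) (mod-refl {x = v * N})) ⟩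
      ι * (v * Q + (c - S) * (c - S) - v * N)          ≡⟨ cong (ι *_) (identity₃ (v * Q) (c - S) (v * N)) ⟩
      ι * ((c - S) * (c - S) + v * Q - v * N)          ≈⟨ ≡0-*ˡ ι f≡0 ⟩
      + 0                                              ∎
      where
        identity₂ : ∀ v ι Q y N → v * (ι * (Q + v * (y * y) - N)) ≡ ι * (v * Q + (v * y) * (v * y) - v * N)
        identity₂ = solve-∀
        identity₃ : ∀ A B C → A + B * B - C ≡ B * B + A - C
        identity₃ = solve-∀

module Equation (m : ℤ) (n : ℕ) (a : Fin (suc n) → ℕ) {p : ℕ} (A B K : ℤₚ p) where

  c N : ℕ → ℤ
  c k = res B k + res K k * (m - + 2)
  N k = + 2 * res A k + res B k + res K k * (m - + 4)

  equation : (Fin n → ℤₚ p) → ℕ → ℤ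
  equation x k = (c k - Σℤ n (λ i → + a (suc i) * res (x i) k)) * (c k - Σℤ n (λ i → + a (suc i) * res (x i) k))
                 + Σℤ n (λ i → + a zero * + a (suc i) * (res (x i) k * res (x i) k))
                 - (+ 2 * res A k * + a zero + res B k * + a zero + res K k * (m - + 4) * + a zero)

  Solution : Set
  Solution = Σ (Fin n → ℤₚ p) λ x → Primitive x × (∀ k → + (p ^ k) ∣ equation x k)

  system⇒equation : ∀ {M} k (X : Fin (suc n) → ℤ) (x : Fin n → ℤₚ p) → (∀ i → res (x i) k ≡ X (suc i)) →
    Σℤ (suc n) (λ i → + a i * X i) ≡ c k mod M →
    Σℤ (suc n) (λ i → + a i * (X i * X i)) ≡ N k mod M →
    equation x k ≡ + 0 mod M
  system⇒equation {M} k X x x≡X linear quadratic = begin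
    equation x k
      ≡⟨ cong₂ (λ l q → (c k - l) * (c k - l) + q - R) Σ-linear Σ-quadratic ⟩
    (c k - L) * (c k - L) + a₀ * Q - R
      ≡⟨ cong (λ r → (c k - L) * (c k - L) + a₀ * Q - r) (identity₁ (res A k) (res B k) (res K k) m a₀) ⟩
    (c k - L) * (c k - L) + a₀ * Q - a₀ * N k
      ≈⟨ mod-- (mod-+ (mod-* c-L≡a₀X₀ c-L≡a₀X₀) (mod-refl {x = a₀ * Q})) (mod-refl {x = a₀ * N k}) ⟩
    a₀ * X (zero) * (a₀ * X zero) + a₀ * Q - a₀ * N k
      ≡⟨ identity₂ a₀ (X zero) Q (N k) ⟩
    a₀ * (a₀ * (X zero * X zero) + Q) - a₀ * N k
      ≈⟨ mod-- (mod-*ˡ a₀ quadratic) (mod-refl {x = a₀ * N k}) ⟩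
    a₀ * N k - a₀ * N k
      ≡⟨ ℤP.+-inverseʳ (a₀ * N k) ⟩
    + 0 ∎
    where
      open mod-Reasoning M
      a₀ L Q R : ℤ
      a₀ = + a zero
      L = Σℤ n (λ i → + a (suc i) * X (suc i))
      Q = Σℤ n (λ i → + a (suc i) * (X (suc i) * X (suc i)))
      R = + 2 * res A k * + a zero + res B k * + a zero + res K k * (m - + 4) * + a zero
      Σ-linear : Σℤ n (λ i → + a (suc i) * res (x i) k) ≡ L
      Σ-linear = Σℤ-cong n (λ i → cong (+ a (suc i) *_) (x≡X i))
      Σ-quadratic : Σℤ n (λ i → a₀ * + a (suc i) * (res (x i) k * res (x i) k)) ≡ a₀ * Q
      Σ-quadratic = trans (Σℤ-cong n (λ i → trans (cong (λ t → a₀ * + a (suc i) * (t * t)) (x≡X i))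
                                                  (ℤP.*-assoc a₀ (+ a (suc i)) (X (suc i) * X (suc i)))))
                          (Σℤ-*ˡ n a₀ _)
      c-L≡a₀X₀ : c k - L ≡ a₀ * X zero mod M
      c-L≡a₀X₀ = mod-trans (mod-- (mod-sym linear) (mod-refl {x = L})) (≡⇒mod (identity₃ (a₀ * X zero) L))
        where identity₃ : ∀ u L → u + L - L ≡ u
              identity₃ = solve-∀
      identity₁ : ∀ A B K m a → + 2 * A * a + B * a + K * (m - + 4) * a ≡ a * (+ 2 * A + B + K * (m - + 4))
      identity₁ = solve-∀
      identity₂ : ∀ a X Q N → a * X * (a * X) + a * Q - a * N ≡ a * (a * (X * X) + Q) - a * N
      identity₂ = solve-∀

module FiveUnits (m : ℤ) (n : ℕ) (a : Fin (suc n) → ℕ) {p : ℕ} (p-prime : Prime p) (p≢2 : p ≢ 2) (A B K : ℤₚ p)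
  (I : Fin 5 → Fin (suc n)) (I-injective : Injective _≡_ _≡_ I) (units : ∀ t → IsUnitℤₚ p (+ a (I t)))
  (j₀ : Fin n) (I₀≡suc-j₀ : I zero ≡ suc j₀) (v₀+v₁≢0 : ¬ + a (I zero) + + a (I (suc zero)) ≡ + 0 mod + p)
  where

  open ModPrime p-prime
  open OddPrime p-prime p≢2
  open PAdic p
  open Equation m n a A B K

  v : Fin 5 → ℤ
  v t = + a (I t)

  v₀ v₁ v₂ v₃ v₄ : ℤ
  v₀ = v zero
  v₁ = v (suc zero)
  v₂ = v (suc (suc zero))
  v₃ = v (suc (suc (suc zero)))
  v₄ = v (suc (suc (suc (suc zero))))

  v≢0 : ∀ t → ¬ v t ≡ + 0 mod P
  v≢0 t = unit⇒≢0 p-prime (units t)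

  z : DiagonalSolution v₀ v₁ v₂ v₃ (c 1) (N 1)
  z = diagonal-solution (v≢0 zero) (v≢0 (suc zero)) (v≢0 (suc (suc zero))) (v≢0 (suc (suc (suc zero)))) v₀+v₁≢0 (c 1) (N 1)
  open DiagonalSolution z

  S Q : ℤ → ℤ
  S t = v₀ * t + v₁ * z₁ + v₂ * z₂ + v₃ * z₃
  Q t = v₀ * (t * t) + v₁ * (z₁ * z₁) + v₂ * (z₂ * z₂) + v₃ * (z₃ * z₃)

  -- Substituting y₄ = (c − S y₀) / v₄ leaves v₄ times the quadratic equation as f y₀ = 0.
  f D : ℕ → ℤ → ℤ
  f k t = (c k - S t) * (c k - S t) + v₄ * Q t - v₄ * N k
  D k t = - (+ 2 * v₀ * (c k - S t)) + + 2 * v₄ * v₀ * t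

  α : ℤ
  α = v₀ * v₀ + v₄ * v₀

  c-compat : ∀ k → c (suc k) ≡ c k mod P^ k
  c-compat k = mod-+ (res-compat B k) (mod-* (res-compat K k) (mod-refl {x = m - + 2}))

  N-compat : ∀ k → N (suc k) ≡ N k mod P^ k
  N-compat k = mod-+ (mod-+ (mod-*ˡ (+ 2) (res-compat A k)) (res-compat B k))
                     (mod-* (res-compat K k) (mod-refl {x = m - + 4}))

  c≡c₁ : ∀ k → c (suc k) ≡ c 1 mod P
  c≡c₁ k = mod-+ (res≡res₁ B k) (mod-* (res≡res₁ K k) (mod-refl {x = m - + 2}))

  S-cong : ∀ {M t t′} → t ≡ t′ mod M → S t ≡ S t′ mod M
  S-cong t≡t′ = mod-+ (mod-+ (mod-+ (mod-*ˡ v₀ t≡t′) mod-refl) mod-refl) mod-refl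

  f-compat : ∀ k t → f (suc k) t ≡ f k t mod P^ k
  f-compat k t = mod-- (mod-+ (mod-* c-S c-S) (mod-refl {x = v₄ * Q t})) (mod-*ˡ v₄ (N-compat k))
    where c-S : c (suc k) - S t ≡ c k - S t mod P^ k
          c-S = mod-- (c-compat k) (mod-refl {x = S t})

  taylor : ∀ k t d → f k (t + d) ≡ f k t + D k t * d + α * (d * d)
  taylor k t d = identity (c k) (N k) v₀ v₁ v₂ v₃ v₄ z₁ z₂ z₃ t d
    where
      identity : ∀ c N v₀ v₁ v₂ v₃ v₄ z₁ z₂ z₃ t d →
        (c - (v₀ * (t + d) + v₁ * z₁ + v₂ * z₂ + v₃ * z₃)) * (c - (v₀ * (t + d) + v₁ * z₁ + v₂ * z₂ + v₃ * z₃))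
          + v₄ * (v₀ * ((t + d) * (t + d)) + v₁ * (z₁ * z₁) + v₂ * (z₂ * z₂) + v₃ * (z₃ * z₃)) - v₄ * N
        ≡ ((c - (v₀ * t + v₁ * z₁ + v₂ * z₂ + v₃ * z₃)) * (c - (v₀ * t + v₁ * z₁ + v₂ * z₂ + v₃ * z₃))
            + v₄ * (v₀ * (t * t) + v₁ * (z₁ * z₁) + v₂ * (z₂ * z₂) + v₃ * (z₃ * z₃)) - v₄ * N)
          + (- (+ 2 * v₀ * (c - (v₀ * t + v₁ * z₁ + v₂ * z₂ + v₃ * z₃))) + + 2 * v₄ * v₀ * t) * d
          + (v₀ * v₀ + v₄ * v₀) * (d * d)
      identity = solve-∀

  c₁-S≡0 : c 1 - S z₀ ≡ + 0 mod P
  c₁-S≡0 = mod-diff (mod-sym linear)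

  D₁ : ℤ
  D₁ = + 2 * v₄ * v₀ * z₀

  D₁-inverse : ∃ λ w → D₁ * w ≡ + 1 mod P
  D₁-inverse = inverse (*-≢0 (*-≢0 (*-≢0 (2≢0 p≢2) (v≢0 (suc (suc (suc (suc zero)))))) (v≢0 zero)) z₀≢0)

  D-inverse : ∀ k t → t ≡ z₀ mod P → D (suc k) t * proj₁ D₁-inverse ≡ + 1 mod P
  D-inverse k t t≡z₀ = mod-trans (mod-* D≡D₁ (mod-refl {x = proj₁ D₁-inverse})) (proj₂ D₁-inverse)
    where
      open mod-Reasoning P
      D≡D₁ : D (suc k) t ≡ D₁ mod P
      D≡D₁ = begin
        - (+ 2 * v₀ * (c (suc k) - S t)) + + 2 * v₄ * v₀ * t
          ≈⟨ mod-+ (mod-neg (mod-*ˡ (+ 2 * v₀) (mod-trans (mod-- (c≡c₁ k) (S-cong t≡z₀)) c₁-S≡0)))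
                   (mod-*ˡ (+ 2 * v₄ * v₀) t≡z₀) ⟩
        - (+ 2 * v₀ * + 0) + + 2 * v₄ * v₀ * z₀
          ≡⟨ identity v₀ v₄ z₀ ⟩
        D₁ ∎
        where identity : ∀ v₀ v₄ z₀ → - (+ 2 * v₀ * + 0) + + 2 * v₄ * v₀ * z₀ ≡ + 2 * v₄ * v₀ * z₀
              identity = solve-∀

  root₁ : f 1 z₀ ≡ + 0 mod P
  root₁ = mod-trans (mod-- (mod-+ (mod-* c₁-S≡0 c₁-S≡0) (mod-*ˡ v₄ quadratic)) (mod-refl {x = v₄ * N 1}))
                    (≡⇒mod (identity (v₄ * N 1)))
    where identity : ∀ u → + 0 * + 0 + u - u ≡ + 0
          identity = solve-∀

  open Hensel f D α z₀ (proj₁ D₁-inverse) f-compat taylor D-inverse root₁ using (root; root-is-root; root≡t₀)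

  ι : ℤₚ p
  ι = proj₁ (units (suc (suc (suc (suc zero)))))

  v₄ι≡1 : ∀ k → v₄ * res ι k ≡ + 1 mod P^ k
  v₄ι≡1 = unit-inverse {v₄} (units (suc (suc (suc (suc zero)))))

  last : ℤₚ p
  last = mkℤₚ (λ k → res ι k * (c k - S (res root k)))
    (λ k → ≡0-mod⇒∣ (mod-diff (mod-* (res-compat ι k) (mod-- (c-compat k) (S-cong (res-compat root k))))))

  y : Fin 5 → ℤₚ p
  y zero = root
  y (suc zero) = constant z₁
  y (suc (suc zero)) = constant z₂
  y (suc (suc (suc zero))) = constant z₃
  y (suc (suc (suc (suc zero)))) = last

  X : Fin (suc n) → ℤₚ p
  X = extend (constant (+ 0)) I y

  x : Fin n → ℤₚ p
  x i = X (suc i)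

  system : ∀ k → S (res root k) + v₄ * res last k ≡ c k mod P^ k
                 × Q (res root k) + v₄ * (res last k * res last k) ≡ N k mod P^ k
  system k = eliminate-last v₄ (res ι k) (c k) (N k) (S (res root k)) (Q (res root k)) (res last k)
               (v₄ι≡1 k) (cancel-inverse v₄ (res ι k) _ (v₄ι≡1 k)) (root-is-root k)

  Σ-over-X : ∀ k (h : ℤ → ℤ → ℤ) → (∀ u → h u (+ 0) ≡ + 0) →
    Σℤ (suc n) (λ i → h (+ a i) (res (X i) k)) ≡ Σℤ 5 (λ t → h (v t) (res (y t) k))
  Σ-over-X k h h0≡0 =
    trans (Σℤ-cong (suc n) (λ i → cong (h (+ a i)) (map-extend (λ u → res u k) (constant (+ 0)) I y i)))
          (Σℤ-extend (λ i → h (+ a i)) (λ i → h0≡0 (+ a i)) I I-injective (λ t → res (y t) k))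

  five-terms : ∀ a b c d e → a + (b + (c + (d + (e + + 0)))) ≡ a + b + c + d + e
  five-terms = solve-∀

  linear-sum : ∀ k → Σℤ (suc n) (λ i → + a i * res (X i) k) ≡ S (res root k) + v₄ * res last k
  linear-sum k = trans (Σ-over-X k _*_ ℤP.*-zeroʳ)
                       (five-terms (v₀ * res root k) (v₁ * z₁) (v₂ * z₂) (v₃ * z₃) (v₄ * res last k))

  quadratic-sum : ∀ k → Σℤ (suc n) (λ i → + a i * (res (X i) k * res (X i) k))
                        ≡ Q (res root k) + v₄ * (res last k * res last k)
  quadratic-sum k = trans (Σ-over-X k (λ u t → u * (t * t)) ℤP.*-zeroʳ)
                          (five-terms (v₀ * (r * r)) (v₁ * (z₁ * z₁)) (v₂ * (z₂ * z₂)) (v₃ * (z₃ * z₃)) (v₄ * (l * l)))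
    where r l : ℤ
          r = res root k
          l = res last k

  x-solves : ∀ k → equation x k ≡ + 0 mod P^ k
  x-solves k = system⇒equation k (λ i → res (X i) k) x (λ i → refl)
                 (mod-trans (≡⇒mod (linear-sum k)) (proj₁ (system k)))
                 (mod-trans (≡⇒mod (quadratic-sum k)) (proj₂ (system k)))

  x-primitive : Primitive x
  x-primitive = j₀ , subst (λ u → ¬ In-pℤₚ u) (sym x-j₀≡root) root∉pℤₚ
    where
      x-j₀≡root : x j₀ ≡ root
      x-j₀≡root = subst (λ i → X i ≡ root) I₀≡suc-j₀ (extend-at (constant (+ 0)) I y I-injective zero)
      root∉pℤₚ : ¬ In-pℤₚ root
      root∉pℤₚ root∈pℤₚ = z₀≢0 (mod-trans (mod-sym (root≡t₀ 1)) (∈pℤₚ⇒res₁≡0 {root} root∈pℤₚ))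

  solution : Solution
  solution = x , x-primitive , λ k → ≡0-mod⇒∣ {PAdic.P^_ p k} {equation x k} (x-solves k)

permuted-injective : ∀ {k r} {f : Fin k → Fin r} → Injective _≡_ _≡_ f → (π : Permutation′ k) →
                     Injective _≡_ _≡_ (λ t → f (π ⟨$⟩ʳ t))
permuted-injective f-injective π eq = Injection.injective (↔⇒↣ π) (f-injective eq)

-- The lifted coordinate y₀ must be one of the unknowns xᵢ, so S (π 0) ≢ 0; if it is 0, swap the first two.
first-pair : ∀ {n p} → Prime p → p ≢ 2 → (a : Fin (suc n) → ℕ) (S : Fin 5 → Fin (suc n)) → Injective _≡_ _≡_ S →
  (∀ t → ¬ + a (S t) ≡ + 0 mod + p) →
  ∃ λ (π : Permutation′ 5) → (∃ λ j₀ → S (π ⟨$⟩ʳ zero) ≡ suc j₀)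
                           × ¬ (+ a (S (π ⟨$⟩ʳ zero)) + + a (S (π ⟨$⟩ʳ suc zero)) ≡ + 0 mod + p)
first-pair {p = p} p-prime p≢2 a S S-injective a≢0 =
  let π , sum≢0 = OddPrime.unit-sum-first p-prime p≢2 (λ t → + a (S t)) (a≢0 zero)
  in  by-first-indices π sum≢0 (S (π ⟨$⟩ʳ zero)) refl (S (π ⟨$⟩ʳ suc zero)) refl
  where
    unit-sum : Permutation′ 5 → Set
    unit-sum π = ¬ (+ a (S (π ⟨$⟩ʳ zero)) + + a (S (π ⟨$⟩ʳ suc zero)) ≡ + 0 mod + p)

    by-first-indices : ∀ π → unit-sum π → ∀ i₀ → S (π ⟨$⟩ʳ zero) ≡ i₀ → ∀ i₁ → S (π ⟨$⟩ʳ suc zero) ≡ i₁ →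
                       ∃ λ π → (∃ λ j₀ → S (π ⟨$⟩ʳ zero) ≡ suc j₀) × unit-sum π
    by-first-indices π sum≢0 (suc j₀) S₀≡ _ _ = π , (j₀ , S₀≡) , sum≢0
    by-first-indices π _ zero S₀≡ zero S₁≡ =
      ⊥-elim (FinP.0≢1+n (permuted-injective S-injective π (trans S₀≡ (sym S₁≡))))
    by-first-indices π sum≢0 zero _ (suc j₀) S₁≡ =
      transpose zero (suc zero) ∘ₚ π , (j₀ , S₁≡) ,
      λ ≡0 → sum≢0 (mod-trans (≡⇒mod (ℤP.+-comm (+ a (S (π ⟨$⟩ʳ zero))) (+ a (S (π ⟨$⟩ʳ suc zero))))) ≡0)

proposition3p2 : (m : ℤ) → + 3 ≤ m → (n : ℕ) → (a : Fin (suc n) → ℕ) → (∀ i → 0 ℕ.< a i) → gcdFin (suc n) a ≡ 1 → (p : ℕ) → Prime p → p ≢ 2 → (Σ (Fin 5 → Fin (suc n)) λ S → Injective _≡_ _≡_ S × (∀ j → IsUnitℤₚ p (+ a (S j)))) → (A B K : ℤₚ p) → Σ (Fin n → ℤₚ p) λ x → Primitive x × (∀ k → (+ (p ^ k)) ∣ ((((res B k + res K k * (m - + 2)) - Σℤ n (λ i → + a (suc i) * res (x i) k)) * ((res B k + res K k * (m - + 2)) - Σℤ n (λ i → + a (suc i) * res (x i) k)) + Σℤ n (λ i → + a zero * + a (suc i) * (res (x i) k * res (x i) k))) - (+ 2 * res A k * + a zero + res B k * + a zero + res K k * (m - + 4) * + a zero)))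
proposition3p2 m _ n a _ _ p p-prime p≢2 (S , S-injective , S-units) A B K =
  let π , (j₀ , S₀≡suc-j₀) , sum≢0 = first-pair p-prime p≢2 a S S-injective (λ t → unit⇒≢0 p-prime (S-units t))
  in  FiveUnits.solution m n a p-prime p≢2 A B K (λ t → S (π ⟨$⟩ʳ t)) (permuted-injective S-injective π)
        (λ t → S-units (π ⟨$⟩ʳ t)) j₀ S₀≡suc-j₀ sum≢0
  where open PAdic p using (unit⇒≢0)
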